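{- For $m\ge 0$ and $n\ge m+3$, $D_f(Q_n;Q_m)\ge n+1$ and $D^{sc}_f(Q_n;Q_m)\ge n+1$.
   Context: The $n$-dimensional hypercube $Q_n$ is the graph whose vertices are the binary strings of length $n$, two vertices being adjacent iff they differ in exactly one position; $Q_0$ is a single vertex. The diameter of a graph is the maximum graph distance between two of its vertices. For a graph $G$ and a graph $W$, a $W$-structure in $G$ is a subgraph isomorphic to $W$; removing a family of subgraphs means deleting all their vertices. $\kappa(G;W)$ is the minimum number $t$ such that there exist $t$ pairwise vertex-disjoint $W$-structures whose removal disconnects $G$, and $D_f(G;W)$ is the maximum diameter of a graph obtained from $G$ by removing at most $\kappa(G;W)-1$ pairwise vertex-disjoint $W$-structures. For $0\le k\le n$, a $k$-subcube of $Q_n$ is a vertex set whose induced subgraph is isomorphic to $Q_k$. $\kappa^{sc}(Q_n;Q_m)$ is the minimum number of pairwise disjoint vertex sets, each a $k$-subcube of $Q_n$ for some $0\le k\le m$, whose deletion disconnects $Q_n$, and $D^{sc}_f(Q_n;Q_m)$ is the maximum diameter of $Q_n-\bigcup\mathcal{F}$ over all families $\mathcal{F}$ of at most $\kappa^{sc}(Q_n;Q_m)-1$ pairwise disjoint vertex sets, each a $k$-subcube of $Q_n$ for some $0\le k\le m$. -}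

module Defs where

open import Data.Nat using (ℕ; zero; suc; _+_; _≤_)
open import Data.Bool using (Bool)
open import Data.Fin using (Fin)
open import Data.Vec using (Vec; lookup)
open import Data.Product using (Σ; ∃; _×_; _,_)
open import Relation.Nullary using (¬_)
open import Relation.Binary.PropositionalEquality using (_≡_; _≢_)

Cube : ℕ → Set
Cube n = Vec Bool n

Adj : ∀ {n} → Cube n → Cube n → Set
Adj {n} u v = Σ (Fin n) λ i →
  (lookup u i ≢ lookup v i) × (∀ j → j ≢ i → lookup u j ≡ lookup v j)

-- A Q_m-structure in Q_n: a subgraph isomorphic to Q_m, i.e. an injective
-- graph homomorphism Q_m → Q_n (its vertex set is the image).
record QStr (m n : ℕ) : Set where
  field
    emb : Cube m → Cube n
    inj : ∀ x y → emb x ≡ emb y → x ≡ y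
    hom : ∀ x y → Adj x y → Adj (emb x) (emb y)

QImg : ∀ {m n} → QStr m n → Cube n → Set
QImg s v = ∃ λ x → QStr.emb s x ≡ v

-- A k-subcube of Q_n with k ≤ m: a vertex set whose induced subgraph is
-- isomorphic to Q_k, i.e. the image of an induced embedding Q_k → Q_n.
record SubCube (m n : ℕ) : Set where
  field
    k    : ℕ
    k≤m  : k ≤ m
    emb  : Cube k → Cube n
    inj  : ∀ x y → emb x ≡ emb y → x ≡ y
    hom  : ∀ x y → Adj x y → Adj (emb x) (emb y)
    refl : ∀ x y → Adj (emb x) (emb y) → Adj x y

SCImg : ∀ {m n} → SubCube m n → Cube n → Set
SCImg s v = ∃ λ x → SubCube.emb s x ≡ v

data WalkIn {n : ℕ} (S : Cube n → Set) : Cube n → Cube n → ℕ → Set where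
  here : ∀ {u} → S u → WalkIn S u u zero
  step : ∀ {u w v ℓ} → S u → Adj u w → WalkIn S w v ℓ → WalkIn S u v (suc ℓ)

module _ {n : ℕ} {St : Set} (img : St → Cube n → Set) where

  Removed : ∀ {t} → (Fin t → St) → Cube n → Set
  Removed F v = ∃ λ i → img (F i) v

  Survives : ∀ {t} → (Fin t → St) → Cube n → Set
  Survives F v = ¬ Removed F v

  PairwiseDisjoint : ∀ {t} → (Fin t → St) → Set
  PairwiseDisjoint F = ∀ i j v → img (F i) v → img (F j) v → i ≡ j

  Disconnects : ∀ {t} → (Fin t → St) → Set
  Disconnects F = ∃ λ u → ∃ λ v →
    Survives F u × Survives F v × (∀ ℓ → ¬ WalkIn (Survives F) u v ℓ)

  IsKappa : ℕ → Set
  IsKappa k =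
    (Σ (Fin k → St) λ F → PairwiseDisjoint F × Disconnects F) ×
    (∀ t (F : Fin t → St) → PairwiseDisjoint F → Disconnects F → k ≤ t)

  DiamAtLeast : ∀ {t} → (Fin t → St) → ℕ → Set
  DiamAtLeast F d = ∃ λ u → ∃ λ v →
    Survives F u × Survives F v × (∀ ℓ → WalkIn (Survives F) u v ℓ → d ≤ ℓ)

  -- The fault diameter (max over families of at most κ - 1 pairwise disjoint
  -- structures) is ≥ d.
  FaultDiamAtLeast : ℕ → Set
  FaultDiamAtLeast d = ∃ λ κ → IsKappa κ × ∃ λ t → suc t ≤ κ ×
    Σ (Fin t → St) λ F → PairwiseDisjoint F × DiamAtLeast F d

{-# OPTIONS --safe #-}

-- Let K = n − m.  An injective homomorphism Q_k → Q_n sends parallel edges of Q_k to edges that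
-- flip one and the same coordinate, so its image is a subcube; hence every Q_m-structure and
-- every k-subcube with k ≤ m is a subcube of codimension ≥ K.  Splitting Q_n into its two halves
-- along the first coordinate, induction on n shows that fewer than c subcubes of codimension
-- ≥ c never disconnect Q_n, so κ ≥ K.  The K layers e_i × Q_m cut the block 0^K × Q_m off the
-- rest, so κ = K.  Removing all layers but e_1 × Q_m, a walk from 0^n to 0 1^(n−1) must leave
-- the block through that layer and later flip the first coordinate back, so it needs n + 1
-- steps; for 0 1^(n−1) to survive the removal the block needs K ≥ 3 coordinates.

module Submission where

open import Data.Bool using (Bool; true; false; not; if_then_else_; _xor_) renaming (_≟_ to _≟ᵇ_)
open import Data.Bool.Properties using (not-involutive; not-¬; ¬-not)
open import Data.Fin using (Fin; zero; suc)
open import Data.Fin.Properties using (suc-injective) renaming (_≟_ to _≟ᶠ_)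
open import Data.List using (List; []; _∷_; length; tabulate) renaming (map to mapₗ)
open import Data.List.Properties using (length-map; length-tabulate)
open import Data.List.Relation.Unary.All using (All; []; _∷_; zip) renaming (map to mapᴬ)
import Data.List.Relation.Unary.All.Properties as All
open import Data.List.Relation.Unary.Any using (Any; here; there; any?) renaming (map to mapᴬⁿʸ)
import Data.List.Relation.Unary.Any.Properties as Any
open import Data.Maybe using (Maybe; just; nothing)
open import Data.Maybe.Properties using (≡-dec)
open import Data.Nat using (ℕ; zero; suc; _+_; _≤_; _<_; z≤n; s≤s; s≤s⁻¹; _≤?_)
open import Data.Nat.Properties hiding (suc-injective; _≟_)
open import Algebra.Properties.CommutativeSemigroup +-commutativeSemigroup using (x∙yz≈y∙xz)
open import Data.Product using (∃; ∃₂; _×_; _,_; proj₁; proj₂)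
open import Data.Sum using (_⊎_; inj₁; inj₂; [_,_])
import Data.Sum as Sum
open import Data.Unit using (⊤; tt)
open import Data.Vec using (Vec; []; _∷_; head; tail; lookup; _++_; replicate; map; _[_]%=_; _[_]≔_)
open import Data.Vec.Properties
  using (lookup∘updateAt; lookup∘updateAt′; ∷-injectiveʳ; ++-injectiveˡ; ++-injectiveʳ)
open import Data.Vec.Relation.Binary.Pointwise.Extensional using (ext; Pointwise-≡⇒≡)
open import Function using (_∘_; id)
open import Function.Bundles using (_⇔_; mk⇔; Equivalence)
open import Relation.Nullary using (¬_; Dec; yes; no; contradiction)
open import Relation.Binary.PropositionalEquality
  using (_≡_; _≢_; refl; sym; trans; cong; cong₂; subst; module ≡-Reasoning)

open import Defs

open Equivalence using (to; from)

private
  variable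
    k m n : ℕ

flipAt : Fin n → Cube n → Cube n
flipAt i u = u [ i ]%= not

flipAt-involutive : ∀ (i : Fin n) u → flipAt i (flipAt i u) ≡ u
flipAt-involutive zero    (a ∷ u) = cong (_∷ u) (not-involutive a)
flipAt-involutive (suc i) (a ∷ u) = cong (a ∷_) (flipAt-involutive i u)

flipAt-swap : ∀ (i : Fin n) {u v} → flipAt i u ≡ v → u ≡ flipAt i v
flipAt-swap i {u} refl = sym (flipAt-involutive i u)

lookup-flipAt-≢ : ∀ (i : Fin n) u → lookup u i ≢ lookup (flipAt i u) i
lookup-flipAt-≢ i u eq = not-¬ refl (trans eq (lookup∘updateAt i u))

flipAt-≢ : ∀ (i : Fin n) u → flipAt i u ≢ u
flipAt-≢ i u eq = lookup-flipAt-≢ i u (cong (λ w → lookup w i) (sym eq))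

flipAt-injectiveˡ : ∀ {i j : Fin n} u → flipAt i u ≡ flipAt j u → i ≡ j
flipAt-injectiveˡ {i = i} {j} u eq with i ≟ᶠ j
... | yes i≡j = i≡j
... | no  i≢j = contradiction (sym (trans (cong (λ w → lookup w i) eq) (lookup∘updateAt′ i j i≢j u)))
                  (lookup-flipAt-≢ i u)

adj-flipAt : ∀ (i : Fin n) u → Adj u (flipAt i u)
adj-flipAt i u = i , lookup-flipAt-≢ i u , λ j j≢i → sym (lookup∘updateAt′ j i j≢i u)

adj⇒flipAt : ∀ {u v : Cube n} → Adj u v → ∃ λ i → v ≡ flipAt i u
adj⇒flipAt {u = u} {v} (i , uᵢ≢vᵢ , same) = i , Pointwise-≡⇒≡ (ext agree)
  where
  agree : ∀ j → lookup v j ≡ lookup (flipAt i u) j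
  agree j with j ≟ᶠ i
  ... | yes refl = trans (¬-not (uᵢ≢vᵢ ∘ sym)) (sym (lookup∘updateAt i u))
  ... | no j≢i   = trans (sym (same j j≢i)) (sym (lookup∘updateAt′ j i j≢i u))

adj-head : ∀ {a b} (u : Cube n) → a ≢ b → Adj (a ∷ u) (b ∷ u)
adj-head u a≢b = zero , a≢b , λ where
  zero    0≢0 → contradiction refl 0≢0
  (suc j) _   → refl

adj-∷ : ∀ b {u v : Cube n} → Adj u v → Adj (b ∷ u) (b ∷ v)
adj-∷ b (i , uᵢ≢vᵢ , same) = suc i , uᵢ≢vᵢ , λ where
  zero    _   → refl
  (suc j) j≢i → same j (j≢i ∘ cong suc)

adj-∷⁻ : ∀ b {u v : Cube n} → Adj (b ∷ u) (b ∷ v) → Adj u v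
adj-∷⁻ b (zero  , b≢b , _)      = contradiction refl b≢b
adj-∷⁻ b (suc i , uᵢ≢vᵢ , same) = i , uᵢ≢vᵢ , λ j j≢i → same (suc j) (j≢i ∘ suc-injective)

adj-++ : ∀ (p : Vec Bool k) {u v : Cube n} → Adj u v → Adj (p ++ u) (p ++ v)
adj-++ []      = id
adj-++ (b ∷ p) = adj-∷ b ∘ adj-++ p

adj-++⁻ : ∀ (p : Vec Bool k) {u v : Cube n} → Adj (p ++ u) (p ++ v) → Adj u v
adj-++⁻ []      = id
adj-++⁻ (b ∷ p) = adj-++⁻ p ∘ adj-∷⁻ b

flipAt-++ : ∀ (p : Vec Bool k) (i : Fin (k + n)) x →
  (∃ λ i′ → flipAt i (p ++ x) ≡ flipAt i′ p ++ x) ⊎ (∃ λ y → Adj x y × flipAt i (p ++ x) ≡ p ++ y)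
flipAt-++ []      i       x = inj₂ (flipAt i x , adj-flipAt i x , refl)
flipAt-++ (a ∷ p) zero    x = inj₁ (zero , refl)
flipAt-++ (a ∷ p) (suc i) x with flipAt-++ p i x
... | inj₁ (i′ , eq)     = inj₁ (suc i′ , cong (a ∷_) eq)
... | inj₂ (y , x~y , eq) = inj₂ (y , x~y , cong (a ∷_) eq)

adj-++-cases : ∀ (p : Vec Bool k) {x : Cube n} {w} → Adj (p ++ x) w →
  (∃ λ i → w ≡ flipAt i p ++ x) ⊎ (∃ λ y → Adj x y × w ≡ p ++ y)
adj-++-cases p {x} {w} a with i , refl ← adj⇒flipAt {u = p ++ x} {w} a = flipAt-++ p i x

zeros ones : ∀ n → Cube n
zeros n = replicate n false
ones  n = replicate n true

unit : Fin k → Vec Bool k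
unit {k} i = flipAt i (zeros k)

Reachable : (Cube n → Set) → Cube n → Cube n → Set
Reachable S u v = ∃ (WalkIn S u v)

module _ {S : Cube n → Set} where

  walk-start : ∀ {u v ℓ} → WalkIn S u v ℓ → S u
  walk-start (here s)     = s
  walk-start (step s _ _) = s

  walk-++ : ∀ {u w v ℓ ℓ′} → WalkIn S u w ℓ → WalkIn S w v ℓ′ → WalkIn S u v (ℓ + ℓ′)
  walk-++ (here _)        q = q
  walk-++ (step s u~w p) q = step s u~w (walk-++ p q)

  reachable-trans : ∀ {u w v} → Reachable S u w → Reachable S w v → Reachable S u v
  reachable-trans (_ , p) (_ , q) = _ , walk-++ p q

walk-map : ∀ {S : Cube n → Set} {T : Cube m → Set} (f : Cube n → Cube m) →
  (∀ {x y} → Adj x y → Adj (f x) (f y)) → (∀ {x} → S x → T (f x)) →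
  ∀ {u v ℓ} → WalkIn S u v ℓ → WalkIn T (f u) (f v) ℓ
walk-map f hom S⇒T (here s)         = here (S⇒T s)
walk-map f hom S⇒T (step s u~w rest) = step (S⇒T s) (hom u~w) (walk-map f hom S⇒T rest)

reachable-head : ∀ {S : Cube (suc n) → Set} a b x →
  S (a ∷ x) → S (b ∷ x) → Reachable S (a ∷ x) (b ∷ x)
reachable-head a b x s s′ with a ≟ᵇ b
... | yes refl = 0 , here s
... | no  a≢b  = 1 , step s (adj-head x a≢b) (here s′)

hamming : Cube n → Cube n → ℕ
hamming []      []      = 0
hamming (a ∷ u) (b ∷ v) = (if a xor b then 1 else 0) + hamming u v

hamming-refl : ∀ (u : Cube n) → hamming u u ≡ 0
hamming-refl []          = refl
hamming-refl (false ∷ u) = hamming-refl u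
hamming-refl (true ∷ u)  = hamming-refl u

hamming-flipAt : ∀ (i : Fin n) u w → hamming u w ≤ suc (hamming (flipAt i u) w)
hamming-flipAt zero (false ∷ u) (false ∷ w) = m≤n+m _ 2
hamming-flipAt zero (false ∷ u) (true ∷ w)  = ≤-refl
hamming-flipAt zero (true ∷ u)  (false ∷ w) = ≤-refl
hamming-flipAt zero (true ∷ u)  (true ∷ w)  = m≤n+m _ 2
hamming-flipAt (suc i) (a ∷ u) (b ∷ w) = begin
  d + hamming u w                 ≤⟨ +-monoʳ-≤ d (hamming-flipAt i u w) ⟩
  d + suc (hamming (flipAt i u) w) ≡⟨ +-suc d _ ⟩
  suc (d + hamming (flipAt i u) w) ∎
  where
  open ≤-Reasoning
  d : ℕ
  d = if a xor b then 1 else 0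

hamming-adj : ∀ {u v : Cube n} w → Adj u v → hamming u w ≤ suc (hamming v w)
hamming-adj {u = u} {v} w u~v with i , refl ← adj⇒flipAt {u = u} {v} u~v = hamming-flipAt i u w

hamming≤length : ∀ {S : Cube n → Set} {u v ℓ} → WalkIn S u v ℓ → hamming u v ≤ ℓ
hamming≤length {u = u} (here _)         = ≤-reflexive (hamming-refl u)
hamming≤length {u = u} {v} (step {w = w} _ u~w rest) =
  ≤-trans (hamming-adj {u = u} {w} v u~w) (s≤s (hamming≤length rest))

hamming-++ : ∀ (p q : Vec Bool k) (x y : Cube n) → hamming (p ++ x) (q ++ y) ≡ hamming p q + hamming x y
hamming-++ []      []      x y = refl
hamming-++ (a ∷ p) (b ∷ q) x y =
  trans (cong (d +_) (hamming-++ p q x y)) (sym (+-assoc d (hamming p q) (hamming x y)))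
  where
  d : ℕ
  d = if a xor b then 1 else 0

hamming-zeros-ones : ∀ n (u : Cube n) → hamming (zeros n) u + hamming u (ones n) ≡ n
hamming-zeros-ones zero    []          = refl
hamming-zeros-ones (suc n) (false ∷ u) = trans (+-suc _ _) (cong suc (hamming-zeros-ones n u))
hamming-zeros-ones (suc n) (true ∷ u)  = cong suc (hamming-zeros-ones n u)

-- Subcubes

Pattern : ℕ → Set
Pattern n = Vec (Maybe Bool) n

_fits_ : Bool → Maybe Bool → Set
b fits nothing = ⊤
b fits just c  = b ≡ c

fits? : ∀ b h → Dec (b fits h)
fits? b nothing  = yes tt
fits? b (just c) = b ≟ᵇ c

infix 4 _∈ₚ_

_∈ₚ_ : Cube n → Pattern n → Set
[]      ∈ₚ []    = ⊤
(b ∷ v) ∈ₚ P     = b fits head P × v ∈ₚ tail P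

codim : Pattern n → ℕ
codim []            = 0
codim (nothing ∷ P) = codim P
codim (just _ ∷ P)  = suc (codim P)

point : Cube n → Pattern n
point = map just

codim-point : ∀ (u : Cube n) → codim (point u) ≡ n
codim-point []      = refl
codim-point (_ ∷ u) = cong suc (codim-point u)

∈-point : ∀ {u v : Cube n} → v ∈ₚ point u ⇔ u ≡ v
∈-point {u = u} {v} = mk⇔ (∈⇒≡ u v) (λ { refl → self-∈ u })
  where
  ∈⇒≡ : ∀ {n} (u v : Cube n) → v ∈ₚ point u → u ≡ v
  ∈⇒≡ []      []      _          = refl
  ∈⇒≡ (a ∷ u) (b ∷ v) (b≡a , v∈) = cong₂ _∷_ (sym b≡a) (∈⇒≡ u v v∈)
  self-∈ : ∀ {n} (u : Cube n) → u ∈ₚ point u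
  self-∈ []      = tt
  self-∈ (a ∷ u) = refl , self-∈ u

codim-free : ∀ {c} (P : Pattern n) d → lookup P d ≡ just c → suc (codim (P [ d ]≔ nothing)) ≡ codim P
codim-free (just _ ∷ P)  zero    refl = refl
codim-free (nothing ∷ P) (suc d) eq   = codim-free P d eq
codim-free (just _ ∷ P)  (suc d) eq   = cong suc (codim-free P d eq)

∈-flipAt : ∀ (P : Pattern n) d {v} → lookup P d ≡ nothing → v ∈ₚ P → flipAt d v ∈ₚ P
∈-flipAt (nothing ∷ P) zero    {_ ∷ v} refl (_ , v∈)   = tt , v∈
∈-flipAt (h ∷ P)       (suc d) {_ ∷ v} eq   (a∈ , v∈)  = a∈ , ∈-flipAt P d eq v∈

∈-free : ∀ {c} (P : Pattern n) d {v} → lookup P d ≡ just c →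
  v ∈ₚ P [ d ]≔ nothing ⇔ (v ∈ₚ P ⊎ flipAt d v ∈ₚ P)
∈-free (just c ∷ P) zero {a ∷ v} refl = mk⇔ split merge
  where
  split : ⊤ × v ∈ₚ P → (a ≡ c × v ∈ₚ P) ⊎ (not a ≡ c × v ∈ₚ P)
  split (_ , v∈) with a ≟ᵇ c
  ... | yes a≡c = inj₁ (a≡c , v∈)
  ... | no  a≢c = inj₂ (sym (¬-not (a≢c ∘ sym)) , v∈)
  merge : (a ≡ c × v ∈ₚ P) ⊎ (not a ≡ c × v ∈ₚ P) → ⊤ × v ∈ₚ P
  merge = [ (λ (_ , v∈) → tt , v∈) , (λ (_ , v∈) → tt , v∈) ]
∈-free (h ∷ P) (suc d) {a ∷ v} eq = mk⇔
  (λ (a∈ , v∈) → Sum.map (a∈ ,_) (a∈ ,_) (to (∈-free P d eq) v∈))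
  [ (λ (a∈ , v∈) → a∈ , from (∈-free P d eq) (inj₁ v∈))
  , (λ (a∈ , v∈) → a∈ , from (∈-free P d eq) (inj₂ v∈)) ]

SubcubesOfCodim≥ : ∀ {St : Set} → (St → Cube n → Set) → ℕ → Set
SubcubesOfCodim≥ {St = St} img c = ∀ (s : St) → ∃ λ P → c ≤ codim P × ∀ v → img s v ⇔ v ∈ₚ P

-- Images of injective homomorphisms

Injective : (Cube k → Cube n) → Set
Injective e = ∀ x y → e x ≡ e y → x ≡ y

Homomorphism : (Cube k → Cube n) → Set
Homomorphism e = ∀ x y → Adj x y → Adj (e x) (e y)

Image : (Cube k → Cube n) → Cube n → Set
Image e v = ∃ λ x → e x ≡ v

injective-∷ : ∀ {b} (e : Cube (suc k) → Cube n) → Injective e → Injective (e ∘ (b ∷_))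
injective-∷ e inj x y eq = ∷-injectiveʳ (inj _ _ eq)

homomorphism-∷ : ∀ {b} (e : Cube (suc k) → Cube n) → Homomorphism e → Homomorphism (e ∘ (b ∷_))
homomorphism-∷ {b = b} e hom x y x~y = hom _ _ (adj-∷ b x~y)

edge-constant⇒constant : ∀ {A : Set} (f : Cube k → A) →
  (∀ x y → Adj x y → f x ≡ f y) → ∀ x y → f x ≡ f y
edge-constant⇒constant {zero}  f _     []      []      = refl
edge-constant⇒constant {suc k} f const (a ∷ x) (b ∷ y) =
  trans (edge-constant⇒constant (f ∘ (a ∷_)) (λ x y x~y → const _ _ (adj-∷ a x~y)) x y) change-head
  where
  change-head : f (a ∷ y) ≡ f (b ∷ y)
  change-head with a ≟ᵇ b
  ... | yes refl = refl
  ... | no  a≢b  = const _ _ (adj-head y a≢b)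

square : ∀ {p q r s : Fin n} (a : Cube n) → p ≢ q → r ≢ p →
  flipAt r (flipAt p a) ≡ flipAt s (flipAt q a) → r ≡ q
square {p = p} {q} {r} {s} a p≢q r≢p eq with s ≟ᶠ p
... | no s≢p = contradiction (begin
      lookup a p                        ≡⟨ sym (lookup∘updateAt′ p q p≢q a) ⟩
      lookup (flipAt q a) p             ≡⟨ sym (lookup∘updateAt′ p s (s≢p ∘ sym) (flipAt q a)) ⟩
      lookup (flipAt s (flipAt q a)) p  ≡⟨ cong (λ w → lookup w p) (sym eq) ⟩
      lookup (flipAt r (flipAt p a)) p  ≡⟨ lookup∘updateAt′ p r (r≢p ∘ sym) (flipAt p a) ⟩
      lookup (flipAt p a) p             ∎) (lookup-flipAt-≢ p a)
  where open ≡-Reasoning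
... | yes refl with r ≟ᶠ q
...   | yes r≡q = r≡q
...   | no  r≢q = contradiction (begin
      lookup a q                        ≡⟨ sym (lookup∘updateAt′ q p (p≢q ∘ sym) a) ⟩
      lookup (flipAt p a) q             ≡⟨ sym (lookup∘updateAt′ q r (r≢q ∘ sym) (flipAt p a)) ⟩
      lookup (flipAt r (flipAt p a)) q  ≡⟨ cong (λ w → lookup w q) eq ⟩
      lookup (flipAt p (flipAt q a)) q  ≡⟨ lookup∘updateAt′ q p (p≢q ∘ sym) (flipAt q a) ⟩
      lookup (flipAt q a) q             ∎) (lookup-flipAt-≢ q a)
  where open ≡-Reasoning

parallel-edges : (e : Cube (suc k) → Cube n) → Injective e → Homomorphism e →
  ∃ λ d → ∀ x → e (true ∷ x) ≡ flipAt d (e (false ∷ x))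
parallel-edges {k} {n} e inj hom = direction (zeros k) , λ x →
  trans (rung x) (cong (λ d → flipAt d (e (false ∷ x))) (constant x (zeros k)))
  where
  rung-flip : ∀ x → ∃ λ d → e (true ∷ x) ≡ flipAt d (e (false ∷ x))
  rung-flip x = adj⇒flipAt {u = e (false ∷ x)} {e (true ∷ x)} (hom _ _ (adj-head x λ ()))

  direction : Cube k → Fin n
  direction x = proj₁ (rung-flip x)

  rung : ∀ x → e (true ∷ x) ≡ flipAt (direction x) (e (false ∷ x))
  rung x = proj₂ (rung-flip x)

  -- e maps the square on false ∷ x, false ∷ y, true ∷ y, true ∷ x to a 4-cycle of Q_n.
  direction-adj : ∀ x y → Adj x y → direction x ≡ direction y
  direction-adj x y x~y
    with p , bottom ← adj⇒flipAt {u = e (false ∷ x)} {e (false ∷ y)} (hom _ _ (adj-∷ false x~y))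
       | s , top    ← adj⇒flipAt {u = e (true ∷ x)}  {e (true ∷ y)}  (hom _ _ (adj-∷ true x~y))
       = sym (square (e (false ∷ x)) p≢dx dy≢p closes)
    where
    open ≡-Reasoning
    p≢dx : p ≢ direction x
    p≢dx refl with () ← inj _ _ (trans bottom (sym (rung x)))
    dy≢p : direction y ≢ p
    dy≢p refl with () ← inj _ _ (begin
      e (true ∷ y)                        ≡⟨ rung y ⟩
      flipAt p (e (false ∷ y))            ≡⟨ cong (flipAt p) bottom ⟩
      flipAt p (flipAt p (e (false ∷ x))) ≡⟨ flipAt-involutive p _ ⟩
      e (false ∷ x)                       ∎)
    closes : flipAt (direction y) (flipAt p (e (false ∷ x)))
           ≡ flipAt s (flipAt (direction x) (e (false ∷ x)))
    closes = begin
      flipAt (direction y) (flipAt p (e (false ∷ x)))     ≡⟨ cong (flipAt (direction y)) (sym bottom) ⟩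
      flipAt (direction y) (e (false ∷ y))                ≡⟨ sym (rung y) ⟩
      e (true ∷ y)                                        ≡⟨ top ⟩
      flipAt s (e (true ∷ x))                             ≡⟨ cong (flipAt s) (rung x) ⟩
      flipAt s (flipAt (direction x) (e (false ∷ x)))     ∎

  constant : ∀ x y → direction x ≡ direction y
  constant = edge-constant⇒constant direction direction-adj

image-subcube : (e : Cube k → Cube n) → Injective e → Homomorphism e →
  ∃ λ P → codim P + k ≡ n × (∀ v → Image e v ⇔ v ∈ₚ P)
image-subcube {zero} e _ _ = point (e []) , trans (+-identityʳ _) (codim-point (e [])) , λ v → mk⇔
  (λ { ([] , eq) → from ∈-point eq })
  (λ v∈ → [] , to ∈-point v∈)
image-subcube {suc k} {n} e inj hom
  with P , codim-P , image₀⇔P ← image-subcube (e ∘ (false ∷_)) (injective-∷ e inj) (homomorphism-∷ e hom)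
     | d , rung ← parallel-edges e inj hom
  with lookup P d in P[d]
... | nothing
  -- otherwise P, the image of e ∘ (false ∷_), would contain e (true ∷ 0)
  with _ , rung′ ← from (image₀⇔P _) (∈-flipAt P d P[d] (to (image₀⇔P _) (zeros k , refl)))
  with () ← inj _ _ (trans rung′ (sym (rung (zeros k))))
... | just c = P [ d ]≔ nothing , codim-Q , λ v → mk⇔ (image⇒∈ v) (∈⇒image v)
  where
  codim-Q : codim (P [ d ]≔ nothing) + suc k ≡ n
  codim-Q = trans (+-suc _ k) (trans (cong (_+ k) (codim-free P d P[d])) codim-P)
  image⇒∈ : ∀ v → Image e v → v ∈ₚ P [ d ]≔ nothing
  image⇒∈ v (false ∷ x , eq) = from (∈-free P d P[d]) (inj₁ (to (image₀⇔P v) (x , eq)))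
  image⇒∈ v (true ∷ x , eq)  = from (∈-free P d P[d])
    (inj₂ (to (image₀⇔P _) (x , flipAt-swap d (trans (sym (rung x)) eq))))
  ∈⇒image : ∀ v → v ∈ₚ P [ d ]≔ nothing → Image e v
  ∈⇒image v v∈ with to (∈-free P d P[d]) v∈
  ... | inj₁ v∈P  = let x , eq = from (image₀⇔P v) v∈P in false ∷ x , eq
  ... | inj₂ v′∈P = let x , eq = from (image₀⇔P _) v′∈P in
    true ∷ x , trans (rung x) (sym (flipAt-swap d (sym eq)))

image-subcube-codim : ∀ {K} (e : Cube k → Cube (K + m)) → Injective e → Homomorphism e → k ≤ m →
  ∃ λ P → K ≤ codim P × ∀ v → Image e v ⇔ v ∈ₚ P
image-subcube-codim {k} {m} {K} e inj hom k≤m =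
  let P , codim-P , image⇔P = image-subcube e inj hom in
  P , +-cancelʳ-≤ m K (codim P) (≤-trans (≤-reflexive (sym codim-P)) (+-monoʳ-≤ (codim P) k≤m)) , image⇔P

QStr-subcubes : ∀ {K} → SubcubesOfCodim≥ (QImg {m} {K + m}) K
QStr-subcubes s = image-subcube-codim (QStr.emb s) (QStr.inj s) (QStr.hom s) ≤-refl

SubCube-subcubes : ∀ {K} → SubcubesOfCodim≥ (SCImg {m} {K + m}) K
SubCube-subcubes s = image-subcube-codim (SubCube.emb s) (SubCube.inj s) (SubCube.hom s) (SubCube.k≤m s)

-- Few subcubes of large codimension neither cover nor disconnect

Covered : List (Pattern n) → Cube n → Set
Covered Ps v = Any (v ∈ₚ_) Ps

Uncovered : List (Pattern n) → Cube n → Set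
Uncovered Ps v = ¬ Covered Ps v

Fixes : Bool → Pattern (suc n) → Set
Fixes b P = head P ≡ just b

fixes? : ∀ b (P : Pattern (suc n)) → Dec (Fixes b P)
fixes? b P = ≡-dec _≟ᵇ_ (head P) (just b)

slice : Bool → List (Pattern (suc n)) → List (Pattern n)
slice b []       = []
slice b (P ∷ Ps) with fits? b (head P)
... | yes _ = tail P ∷ slice b Ps
... | no  _ = slice b Ps

covered-slice : ∀ b (Ps : List (Pattern (suc n))) {v} → Covered Ps (b ∷ v) ⇔ Covered (slice b Ps) v
covered-slice b []       = mk⇔ (λ ()) (λ ())
covered-slice b (P ∷ Ps) with fits? b (head P)
... | yes b-fits = mk⇔
  (λ { (here (_ , v∈)) → here v∈ ; (there cov) → there (to (covered-slice b Ps) cov) })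
  (λ { (here v∈) → here (b-fits , v∈) ; (there cov) → there (from (covered-slice b Ps) cov) })
... | no ¬b-fits = mk⇔
  (λ { (here (b-fits , _)) → contradiction b-fits ¬b-fits ; (there cov) → to (covered-slice b Ps) cov })
  (there ∘ from (covered-slice b Ps))

uncovered-slice : ∀ b (Ps : List (Pattern (suc n))) {v} → Uncovered Ps (b ∷ v) → Uncovered (slice b Ps) v
uncovered-slice b Ps ¬cov = ¬cov ∘ from (covered-slice b Ps)

length-slice : ∀ b (Ps : List (Pattern (suc n))) → length (slice b Ps) ≤ length Ps
length-slice b []       = z≤n
length-slice b (P ∷ Ps) with fits? b (head P)
... | yes _ = s≤s (length-slice b Ps)
... | no  _ = m≤n⇒m≤1+n (length-slice b Ps)

length-slice-< : ∀ b (Ps : List (Pattern (suc n))) → Any (Fixes (not b)) Ps → length (slice b Ps) < length Ps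
length-slice-< b ((h ∷ P) ∷ Ps) (here refl) with fits? b h
... | yes b≡¬b = contradiction b≡¬b (not-¬ refl)
... | no  _    = s≤s (length-slice b Ps)
length-slice-< b ((h ∷ P) ∷ Ps) (there fixed) with fits? b h
... | yes _ = s≤s (length-slice-< b Ps fixed)
... | no  _ = m≤n⇒m≤1+n (length-slice-< b Ps fixed)

All-slice : ∀ {R : Pattern (suc n) → Set} {R′ : Pattern n → Set} b →
  (∀ h Q → b fits h → R (h ∷ Q) → R′ Q) → ∀ Ps → All R Ps → All R′ (slice b Ps)
All-slice b R⇒R′ []             []         = []
All-slice b R⇒R′ ((h ∷ Q) ∷ Ps) (r ∷ rs) with fits? b h
... | yes b-fits = R⇒R′ h Q b-fits r ∷ All-slice b R⇒R′ Ps rs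
... | no  _      = All-slice b R⇒R′ Ps rs

codim-tail : ∀ (P : Pattern (suc n)) → codim P ≤ suc (codim (tail P))
codim-tail (nothing ∷ P) = n≤1+n (codim P)
codim-tail (just _ ∷ P)  = ≤-refl

codim-slice : ∀ {t} b (Ps : List (Pattern (suc n))) →
  All (λ P → suc t ≤ codim P) Ps → All (λ Q → t ≤ codim Q) (slice b Ps)
codim-slice b = All-slice b λ h Q _ t<codim → s≤s⁻¹ (≤-trans t<codim (codim-tail (h ∷ Q)))

codim-slice-unfixed : ∀ {t} b (Ps : List (Pattern (suc n))) → All (λ P → ¬ Fixes b P) Ps →
  All (λ P → t ≤ codim P) Ps → All (λ Q → t ≤ codim Q) (slice b Ps)
codim-slice-unfixed {t = t} b Ps unfixed bounds = All-slice b keep Ps (zip (unfixed , bounds))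
  where
  keep : ∀ h Q → b fits h → ¬ Fixes b (h ∷ Q) × t ≤ codim (h ∷ Q) → t ≤ codim Q
  keep nothing  Q _    (_ , t≤codim)     = t≤codim
  keep (just c) Q refl (¬fixed , _)      = contradiction refl ¬fixed

covered-unfixed : ∀ {a b x} (Ps : List (Pattern (suc n))) → All (λ P → ¬ Fixes b P) Ps →
  Covered Ps (b ∷ x) → Covered Ps (a ∷ x)
covered-unfixed ((nothing ∷ _) ∷ _)  (_ ∷ _)       (here (_ , x∈))  = here (tt , x∈)
covered-unfixed ((just c ∷ _) ∷ _)   (¬fixed ∷ _)  (here (refl , _)) = contradiction refl ¬fixed
covered-unfixed (_ ∷ Ps)             (_ ∷ unfixed) (there cov)      = there (covered-unfixed Ps unfixed cov)

reachable-slice : ∀ b (Ps : List (Pattern (suc n))) {u v} →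
  Reachable (Uncovered (slice b Ps)) u v → Reachable (Uncovered Ps) (b ∷ u) (b ∷ v)
reachable-slice b Ps (ℓ , walk) =
  ℓ , walk-map (b ∷_) (adj-∷ b) (λ ¬cov → ¬cov ∘ to (covered-slice b Ps)) walk

∃-uncovered : ∀ t (Ps : List (Pattern n)) → length Ps ≤ t → All (λ P → t ≤ codim P) Ps →
  ∃ λ v → Uncovered Ps v
∃-uncovered         _       []         _  _          = zeros _ , λ ()
∃-uncovered {zero}  (suc _) ([] ∷ _)   _  (() ∷ _)
∃-uncovered {suc n} zero    (_ ∷ _)    () _
∃-uncovered {suc n} (suc t) Ps         len bounds with any? (fixes? false) Ps
... | no none =
  let v , ¬cov = ∃-uncovered (suc t) (slice false Ps) (≤-trans (length-slice false Ps) len)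
                   (codim-slice-unfixed false Ps (All.¬Any⇒All¬ Ps none) bounds)
  in false ∷ v , ¬cov ∘ to (covered-slice false Ps)
... | yes some =
  let v , ¬cov = ∃-uncovered t (slice true Ps) (s≤s⁻¹ (≤-trans (length-slice-< true Ps some) len))
                   (codim-slice true Ps bounds)
  in true ∷ v , ¬cov ∘ to (covered-slice true Ps)

uncovered-connected : ∀ t (Ps : List (Pattern n)) → length Ps ≤ t → All (λ P → suc t ≤ codim P) Ps →
  ∀ u v → Uncovered Ps u → Uncovered Ps v → Reachable (Uncovered Ps) u v
uncovered-connected {zero}  _ _  _   _      [] [] ¬cov _ = 0 , here ¬cov
-- If no pattern fixes the first coordinate to c, slicing at c keeps every codimension; otherwise
-- each half loses a pattern, and a vertex left uncovered by all tails links the two halves.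
uncovered-connected {suc n} t Ps len bounds (a ∷ u) (b ∷ v) ¬cov-u ¬cov-v =
  by-cases (any? (fixes? true) Ps) (any? (fixes? false) Ps)
  where
  Goal : Set
  Goal = Reachable (Uncovered Ps) (a ∷ u) (b ∷ v)

  through-unfixed-half : ∀ c → ¬ Any (Fixes c) Ps → Goal
  through-unfixed-half c none =
    reachable-trans (reachable-head a c u ¬cov-u ¬cov-u′)
      (reachable-trans (reachable-slice c Ps (uncovered-connected t (slice c Ps)
                          (≤-trans (length-slice c Ps) len) (codim-slice-unfixed c Ps unfixed bounds)
                          u v (uncovered-slice c Ps ¬cov-u′) (uncovered-slice c Ps ¬cov-v′)))
        (reachable-head c b v ¬cov-v′ ¬cov-v))
    where
    unfixed : All (λ P → ¬ Fixes c P) Ps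
    unfixed = All.¬Any⇒All¬ Ps none
    ¬cov-u′ : Uncovered Ps (c ∷ u)
    ¬cov-u′ = ¬cov-u ∘ covered-unfixed Ps unfixed
    ¬cov-v′ : Uncovered Ps (c ∷ v)
    ¬cov-v′ = ¬cov-v ∘ covered-unfixed Ps unfixed

  through-both-halves : ∀ t → length Ps ≤ t → All (λ P → suc t ≤ codim P) Ps →
    Any (Fixes true) Ps → Any (Fixes false) Ps → Goal
  through-both-halves zero    len _      _     someF =
    contradiction (≤-trans (length-slice-< true Ps someF) len) (λ ())
  through-both-halves (suc t) len bounds someT someF =
    reachable-trans (half a u x ¬cov-u (¬cov-x a))
      (reachable-trans (reachable-head a b x (¬cov-x a) (¬cov-x b)) (half b x v (¬cov-x b) ¬cov-v))
    where
    some : ∀ c → Any (Fixes c) Ps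
    some true  = someT
    some false = someF
    x-tails : ∃ λ x → Uncovered (mapₗ tail Ps) x
    x-tails = ∃-uncovered (suc t) (mapₗ tail Ps) (subst (_≤ suc t) (sym (length-map tail Ps)) len)
                (All.map⁺ (mapᴬ (λ {P} t<codim → s≤s⁻¹ (≤-trans t<codim (codim-tail P))) bounds))
    x : Cube n
    x = proj₁ x-tails
    ¬cov-x : ∀ c → Uncovered Ps (c ∷ x)
    ¬cov-x c cov = proj₂ x-tails (Any.map⁺ (mapᴬⁿʸ proj₂ cov))
    half : ∀ c y z → Uncovered Ps (c ∷ y) → Uncovered Ps (c ∷ z) →
      Reachable (Uncovered Ps) (c ∷ y) (c ∷ z)
    half c y z ¬cov-y ¬cov-z = reachable-slice c Ps (uncovered-connected t (slice c Ps)
      (s≤s⁻¹ (≤-trans (length-slice-< c Ps (some (not c))) len)) (codim-slice c Ps bounds)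
      y z (uncovered-slice c Ps ¬cov-y) (uncovered-slice c Ps ¬cov-z))

  by-cases : Dec (Any (Fixes true) Ps) → Dec (Any (Fixes false) Ps) → Goal
  by-cases (no none)   _            = through-unfixed-half true none
  by-cases (yes _)     (no none)    = through-unfixed-half false none
  by-cases (yes someT) (yes someF)  = through-both-halves t len bounds someT someF

few-subcubes-¬disconnect : ∀ {St : Set} {img : St → Cube n → Set} {c t} →
  SubcubesOfCodim≥ img c → t < c → (F : Fin t → St) → ¬ Disconnects img F
few-subcubes-¬disconnect {n} {img = img} {t = t} subcubes t<c F (u , v , u-survives , v-survives , no-walk) =
  let ℓ , walk = uncovered-connected t Ps (≤-reflexive (length-tabulate P)) (All.tabulate⁺ t<codim) u v
                   (survives⇒uncovered u-survives) (survives⇒uncovered v-survives)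
  in no-walk ℓ (walk-map id id uncovered⇒survives walk)
  where
  P : Fin t → Pattern n
  P i = proj₁ (subcubes (F i))
  t<codim : ∀ i → t < codim (P i)
  t<codim i = <-≤-trans t<c (proj₁ (proj₂ (subcubes (F i))))
  img⇔P : ∀ i v → img (F i) v ⇔ v ∈ₚ P i
  img⇔P i = proj₂ (proj₂ (subcubes (F i)))
  Ps : List (Pattern n)
  Ps = tabulate P
  survives⇒uncovered : ∀ {x} → Survives img F x → Uncovered Ps x
  survives⇒uncovered survives cov =
    let i , x∈ = Any.tabulate⁻ cov in survives (i , from (img⇔P i _) x∈)
  uncovered⇒survives : ∀ {x} → Uncovered Ps x → Survives img F x
  uncovered⇒survives ¬cov (i , removed) = ¬cov (Any.tabulate⁺ i (to (img⇔P i _) removed))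

-- Layers around a block

Layer : ∀ m → Fin k → Cube (k + m) → Set
Layer m i = Image {m} (unit i ++_)

layer-disjoint : ∀ (i j : Fin k) {v : Cube (k + m)} → Layer m i v → Layer m j v → i ≡ j
layer-disjoint i j (x , refl) (y , eq) = flipAt-injectiveˡ (zeros _) (sym (++-injectiveˡ (unit j) (unit i) eq))

leave-block : ∀ {S : Cube (k + n) → Set} (p : Vec Bool k) {x w ℓ} → WalkIn S (p ++ x) w ℓ →
  (∃ λ y → w ≡ p ++ y) ⊎
  (∃₂ λ i y → ∃ λ ℓ′ → WalkIn S (flipAt i p ++ y) w ℓ′ × hamming x y + suc ℓ′ ≤ ℓ)
leave-block p {x} (here _) = inj₁ (x , refl)
leave-block p {x} (step {w = w′} {ℓ = ℓ} _ adj rest) with adj-++-cases p {x} {w′} adj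
... | inj₁ (i , refl) = inj₂ (i , x , ℓ , rest , ≤-reflexive (cong (_+ suc ℓ) (hamming-refl x)))
... | inj₂ (y , x~y , refl) with leave-block p rest
...   | inj₁ stays = inj₁ stays
...   | inj₂ (i , z , ℓ′ , rest′ , bound) =
  inj₂ (i , z , ℓ′ , rest′ , ≤-trans (+-monoˡ-≤ (suc ℓ′) (hamming-adj {u = x} {y} z x~y)) (s≤s bound))

module _ {St : Set} (r m : ℕ) (img : St → Cube (3 + r + m) → Set) (layer : Fin (3 + r) → St)
         (layer⇔ : ∀ i v → img (layer i) v ⇔ Layer m i v) where

  origin far : Cube (3 + r + m)
  origin = zeros (3 + r) ++ zeros m
  far    = (false ∷ ones (2 + r)) ++ ones m

  survives : ∀ {t} (g : Fin t → Fin (3 + r)) {v} → (∀ i → ¬ Layer m i v) → Survives img (layer ∘ g) v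
  survives g ∉layer (j , v∈) = ∉layer (g j) (to (layer⇔ (g j) _) v∈)

  removed : ∀ {t} (g : Fin t → Fin (3 + r)) j y → ¬ Survives img (layer ∘ g) (unit (g j) ++ y)
  removed g j y survives = survives (j , from (layer⇔ (g j) _) (y , refl))

  origin∉layer : ∀ i → ¬ Layer m i origin
  origin∉layer i (_ , eq) = flipAt-≢ i (zeros _) (++-injectiveˡ (unit i) (zeros _) eq)

  -- This is where the block needs at least 3 coordinates.
  far∉layer : ∀ i → ¬ Layer m i far
  far∉layer i (_ , eq) = unit≢ i (++-injectiveˡ (unit i) _ eq)
    where
    unit≢ : ∀ i → unit i ≢ false ∷ ones (2 + r)
    unit≢ zero          ()
    unit≢ (suc zero)    ()
    unit≢ (suc (suc i)) ()

  far∉block : ∀ y → far ≢ zeros (3 + r) ++ y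
  far∉block y eq with () ← ++-injectiveˡ (false ∷ ones (2 + r)) (zeros (3 + r)) eq

  layers-disjoint : PairwiseDisjoint img layer
  layers-disjoint i j v v∈i v∈j =
    layer-disjoint i j (to (layer⇔ i v) v∈i) (to (layer⇔ j v) v∈j)

  layers-disconnect : Disconnects img layer
  layers-disconnect = origin , far , survives id origin∉layer , survives id far∉layer , no-walk
    where
    no-walk : ∀ ℓ → ¬ WalkIn (Survives img layer) origin far ℓ
    no-walk ℓ walk with leave-block (zeros (3 + r)) walk
    ... | inj₁ (y , eq)                 = far∉block y eq
    ... | inj₂ (i , y , _ , rest , _)   = removed id i y (walk-start rest)

  hamming-far : ∀ y → hamming (unit zero ++ y) far ≡ 3 + r + hamming y (ones m)
  hamming-far y = trans (hamming-++ (unit zero) (false ∷ ones (2 + r)) y (ones m))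
    (cong (λ d → suc d + hamming y (ones m))
      (trans (cong (_+ hamming (zeros (2 + r)) (ones (2 + r))) (sym (hamming-refl (zeros (2 + r)))))
             (hamming-zeros-ones (2 + r) (zeros (2 + r)))))

  far-distance : ∀ ℓ → WalkIn (Survives img (layer ∘ suc)) origin far ℓ → suc (3 + r + m) ≤ ℓ
  far-distance ℓ walk with leave-block (zeros (3 + r)) walk
  ... | inj₁ (y , eq)                      = contradiction eq (far∉block y)
  ... | inj₂ (suc i , y , _ , rest , _)    = contradiction (walk-start rest) (removed suc i y)
  ... | inj₂ (zero , y , ℓ′ , rest , bound) = begin
    suc (3 + r + m)                         ≡⟨ cong (λ d → suc (3 + r + d)) (sym (hamming-zeros-ones m y)) ⟩
    suc (3 + r + (h₀ + h₁))                 ≡⟨ cong suc (x∙yz≈y∙xz (3 + r) h₀ h₁) ⟩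
    suc (h₀ + (3 + r + h₁))                 ≡⟨ sym (+-suc h₀ (3 + r + h₁)) ⟩
    h₀ + suc (3 + r + h₁)                   ≡⟨ cong (λ d → h₀ + suc d) (sym (hamming-far y)) ⟩
    h₀ + suc (hamming (unit zero ++ y) far) ≤⟨ +-monoʳ-≤ h₀ (s≤s (hamming≤length rest)) ⟩
    h₀ + suc ℓ′                             ≤⟨ bound ⟩
    ℓ                                       ∎
    where
    open ≤-Reasoning
    h₀ h₁ : ℕ
    h₀ = hamming (zeros m) y
    h₁ = hamming y (ones m)

  isKappa : SubcubesOfCodim≥ img (3 + r) → IsKappa img (3 + r)
  isKappa subcubes = (layer , layers-disjoint , layers-disconnect) , minimal
    where
    minimal : ∀ t F → PairwiseDisjoint img F → Disconnects img F → 3 + r ≤ t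
    minimal t F _ disconnects with 3 + r ≤? t
    ... | yes K≤t = K≤t
    ... | no  K≰t = contradiction disconnects (few-subcubes-¬disconnect subcubes (≰⇒> K≰t) F)

  fault-diameter : SubcubesOfCodim≥ img (3 + r) → FaultDiamAtLeast img (suc (3 + r + m))
  fault-diameter subcubes = 3 + r , isKappa subcubes , 2 + r , ≤-refl , layer ∘ suc ,
    (λ i j v v∈i v∈j → suc-injective (layers-disjoint (suc i) (suc j) v v∈i v∈j)) ,
    origin , far , survives suc origin∉layer , survives suc far∉layer , far-distance

layer-QStr : Fin k → QStr m (k + m)
layer-QStr i = record
  { emb = unit i ++_
  ; inj = λ _ _ → ++-injectiveʳ (unit i) (unit i)
  ; hom = λ _ _ → adj-++ (unit i)
  }

layer-SubCube : Fin k → SubCube m (k + m)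
layer-SubCube {m = m} i = record
  { k    = m
  ; k≤m  = ≤-refl
  ; emb  = unit i ++_
  ; inj  = λ _ _ → ++-injectiveʳ (unit i) (unit i)
  ; hom  = λ _ _ → adj-++ (unit i)
  ; refl = λ _ _ → adj-++⁻ (unit i)
  }

block-size : ∀ {m n} → m + 3 ≤ n → ∃ λ r → 3 + r + m ≡ n
block-size {m} m+3≤n =
  let r , eq = m≤n⇒∃[o]m+o≡n m+3≤n in r , trans (+-comm (3 + r) m) (trans (sym (+-assoc m 3 r)) eq)

lemma4p5 : (m n : ℕ) → m + 3 ≤ n →
    FaultDiamAtLeast (QImg {m} {n}) (suc n) × FaultDiamAtLeast (SCImg {m} {n}) (suc n)
lemma4p5 m n m+3≤n with r , refl ← block-size m+3≤n =
  fault-diameter r m QImg layer-QStr (λ _ _ → mk⇔ id id) QStr-subcubes ,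
  fault-diameter r m SCImg layer-SubCube (λ _ _ → mk⇔ id id) SubCube-subcubes
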